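{- Define partial maps $\rho_1,\psi_2$ on partitions as follows, where $j=\lambda_1$ is the length of the first (bottom) row and $k=\lambda'_1$ the height of the first (leftmost) column of $\lambda$ ($j=k=0$ for $\lambda=\emptyset$): - $\rho_1(\lambda)$ is defined iff $j\ge k-2$, and is the partition with column heights $j+1,\lambda'_1-1,\lambda'_2-1,\dots,\lambda'_j-1$ (zeros discarded), i.e. remove the first row, add one box, and insert it as a new first column; - $\psi_2(\lambda)$ is defined iff $j\le k+3$, and is the partition with row lengths $k+2,\lambda_1-1,\dots,\lambda_k-1$ (zeros discarded), i.e. remove the first column, add two boxes, and insert it as a new first row. Then for every $n\ge 0$, each of $\psi_2^n(\emptyset)$, $\psi_2^n(\rho_1(\emptyset))$, $\rho_1(\psi_2^n(\emptyset))$ and $\psi_2(\rho_1(\psi_2^n(\emptyset)))$ is well-defined, i.e. every map application in these compositions is defined.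
   Context: Partitions are drawn as southwest-justified Young diagrams: $\lambda_r$ is the number of boxes in the $r$-th row from the bottom, $\lambda'_c$ the height of the $c$-th column from the left. $\psi_2^n$ denotes $n$-fold composition of $\psi_2$. -}

module Defs where

open import Data.Nat using (ℕ; zero; suc; _+_; _≤_; _≤?_; pred)
open import Data.List using (List; []; _∷_; length; map; filter; upTo)
open import Data.Maybe using (Maybe; just; nothing; _>>=_)
open import Relation.Nullary using (yes; no)
open import Relation.Unary using (∁)
open import Relation.Binary.PropositionalEquality using (_≡_)

-- A partition is represented by its list of row lengths from the bottom row
-- upwards: λ₁ ∷ λ₂ ∷ … (weakly decreasing, positive entries).  ∅ = [].
Partition : Set
Partition = List ℕ

∅ : Partition
∅ = []

firstRow : Partition → ℕ
firstRow []      = 0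
firstRow (x ∷ _) = x

firstCol : Partition → ℕ
firstCol = length

dropZeros : List ℕ → List ℕ
dropZeros = filter (λ x → 1 ≤? x)

conj : Partition → Partition
conj l = map (λ c → length (filter (λ x → suc c ≤? x) l)) (upTo (firstRow l))

-- ρ₁: defined iff j ≥ k - 2 (i.e. k ≤ j + 2); column heights
-- j+1, λ'₁-1, …, λ'_j-1 (zeros discarded); returned as row lengths.
ρ₁ : Partition → Maybe Partition
ρ₁ l with firstCol l ≤? firstRow l + 2
... | yes _ = just (conj (suc (firstRow l) ∷ dropZeros (map pred (conj l))))
... | no  _ = nothing

ψ₂ : Partition → Maybe Partition
ψ₂ l with firstRow l ≤? firstCol l + 3
... | yes _ = just (suc (suc (firstCol l)) ∷ dropZeros (map pred l))
... | no  _ = nothing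

ψ₂^ : ℕ → Partition → Maybe Partition
ψ₂^ zero    l = just l
ψ₂^ (suc n) l = ψ₂^ n l >>= ψ₂

module Submission where

open import Defs
open import Data.Nat using (ℕ)
open import Data.Product using (_×_)
open import Data.Maybe using (Is-just; _>>=_)

open import Data.Nat using (zero; suc; _+_; _≤_; _<_; _≤?_; pred; z≤n; s≤s)
open import Data.Nat.Properties
  using (≤-refl; ≤-trans; ≤-reflexive; +-comm; n≤1+n; pred-mono-≤; m≤n⇒m≤n+o; module ≤-Reasoning)
open import Data.List using ([]; _∷_; length; map; upTo)
open import Data.List.Properties using (length-map; length-upTo; length-filter)
open import Data.Maybe using (Maybe)
open import Data.Maybe.Relation.Unary.Any as Any using (Any; just)
open import Data.Product using (_,_)
open import Data.Unit using (tt)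
open import Function using (id; _∘_; const)
open import Relation.Nullary using (yes; no; contradiction)
open import Relation.Unary using (Pred)
open import Relation.Binary.PropositionalEquality using (_≡_; cong; sym; trans)

-- Along the ψ₂-orbit of ∅ (and of ρ₁ ∅ = (1)) every partition has distinct
-- parts and λ₁ ≤ k + 2.  Distinct parts give k ≤ λ₁, so ρ₁ is defined there;
-- and ψ₂ turns λ into (k + 2, λ₁ - 1, …), where only the last part can vanish,
-- so both properties survive.  Finally, ρ₁ always produces a partition with
-- λ₁ ≤ k, on which ψ₂ is defined.

any->>= : ∀ {a b p q} {A : Set a} {B : Set b} {P : Pred A p} {Q : Pred B q}
          {m : Maybe A} {f : A → Maybe B} →
          Any P m → (∀ {x} → P x → Any Q (f x)) → Any Q (m >>= f)
any->>= (just px) g = g px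

removeFirstColumn : Partition → Partition
removeFirstColumn l = dropZeros (map pred l)

ψ₂′ : Partition → Partition
ψ₂′ l = suc (suc (firstCol l)) ∷ removeFirstColumn l

ρ₁′ : Partition → Partition
ρ₁′ l = conj (suc (firstRow l) ∷ removeFirstColumn (conj l))

ψ₂-defined : ∀ {p} {P : Pred Partition p} {l} →
             firstRow l ≤ firstCol l + 3 → P (ψ₂′ l) → Any P (ψ₂ l)
ψ₂-defined {l = l} j≤k+3 p with firstRow l ≤? firstCol l + 3
... | yes _     = just p
... | no  j≰k+3 = contradiction j≤k+3 j≰k+3

ρ₁-defined : ∀ {p} {P : Pred Partition p} {l} →
             firstCol l ≤ firstRow l + 2 → P (ρ₁′ l) → Any P (ρ₁ l)
ρ₁-defined {l = l} k≤j+2 p with firstCol l ≤? firstRow l + 2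
... | yes _     = just p
... | no  k≰j+2 = contradiction k≤j+2 k≰j+2

length-removeFirstColumn : ∀ l → length (removeFirstColumn l) ≤ length l
length-removeFirstColumn l =
  ≤-trans (length-filter (1 ≤?_) (map pred l)) (≤-reflexive (length-map pred l))

length-conj : ∀ l → length (conj l) ≡ firstRow l
length-conj l = trans (length-map _ (upTo (firstRow l))) (length-upTo (firstRow l))

firstRow-conj : ∀ l → firstRow (conj l) ≤ length l
firstRow-conj []            = z≤n
firstRow-conj (zero ∷ _)    = z≤n
firstRow-conj l@(suc _ ∷ _) = length-filter (1 ≤?_) l

firstRow-ρ₁′≤firstCol : ∀ l → firstRow (ρ₁′ l) ≤ firstCol (ρ₁′ l)
firstRow-ρ₁′≤firstCol l = begin
  firstRow (conj c)                           ≤⟨ firstRow-conj c ⟩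
  length c                                    ≤⟨ s≤s (length-removeFirstColumn (conj l)) ⟩
  suc (length (conj l))                       ≡⟨ cong suc (length-conj l) ⟩
  suc (firstRow l)                            ≡⟨ sym (length-conj c) ⟩
  length (conj c)                             ∎
  where
  open ≤-Reasoning
  c = suc (firstRow l) ∷ removeFirstColumn (conj l)

data Strict : Partition → Set where
  []  : Strict []
  _∷_ : ∀ {x xs} → firstRow xs < x → Strict xs → Strict (x ∷ xs)

length≤firstRow : ∀ {l} → Strict l → length l ≤ firstRow l
length≤firstRow []         = z≤n
length≤firstRow (xs<x ∷ s) = ≤-trans (s≤s (length≤firstRow s)) xs<x

firstRow-removeFirstColumn : ∀ {l} → Strict l →
                             firstRow (removeFirstColumn l) ≤ pred (firstRow l)
firstRow-removeFirstColumn []                      = z≤n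
firstRow-removeFirstColumn (_∷_ {1} {[]} _ _)      = z≤n
firstRow-removeFirstColumn (_∷_ {1} {_ ∷ _} (s≤s z≤n) (() ∷ _))
firstRow-removeFirstColumn (_∷_ {suc (suc _)} _ _) = ≤-refl

length≤suc-length-removeFirstColumn : ∀ {l} → Strict l →
                                      length l ≤ suc (length (removeFirstColumn l))
length≤suc-length-removeFirstColumn []                      = z≤n
length≤suc-length-removeFirstColumn (_∷_ {1} {[]} _ _)      = s≤s z≤n
length≤suc-length-removeFirstColumn (_∷_ {1} {_ ∷ _} (s≤s z≤n) (() ∷ _))
length≤suc-length-removeFirstColumn (_∷_ {suc (suc _)} _ s) =
  s≤s (length≤suc-length-removeFirstColumn s)

Strict-removeFirstColumn : ∀ {l} → Strict l → Strict (removeFirstColumn l)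
Strict-removeFirstColumn []                               = []
Strict-removeFirstColumn (_∷_ {1} {[]} _ _)               = []
Strict-removeFirstColumn (_∷_ {1} {_ ∷ _} (s≤s z≤n) (() ∷ _))
Strict-removeFirstColumn (_∷_ {suc (suc _)} (s≤s xs≤x) s) =
  s≤s (≤-trans (firstRow-removeFirstColumn s) (pred-mono-≤ xs≤x))
  ∷ Strict-removeFirstColumn s

record Invariant (l : Partition) : Set where
  field
    strict  : Strict l
    bounded : firstRow l ≤ 2 + firstCol l

open Invariant

ψ₂′-Invariant : ∀ {l} → Invariant l → Invariant (ψ₂′ l)
ψ₂′-Invariant i .strict  =
  s≤s (≤-trans (firstRow-removeFirstColumn (i .strict)) (pred-mono-≤ (i .bounded)))
  ∷ Strict-removeFirstColumn (i .strict)
ψ₂′-Invariant i .bounded = s≤s (s≤s (length≤suc-length-removeFirstColumn (i .strict)))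

ψ₂-Invariant : ∀ {l} → Invariant l → Any Invariant (ψ₂ l)
ψ₂-Invariant {l} i = ψ₂-defined j≤k+3 (ψ₂′-Invariant i)
  where
  j≤k+3 : firstRow l ≤ firstCol l + 3
  j≤k+3 = ≤-trans (i .bounded) (≤-trans (n≤1+n _) (≤-reflexive (+-comm 3 (firstCol l))))

ψ₂^-Invariant : ∀ n {l} → Invariant l → Any Invariant (ψ₂^ n l)
ψ₂^-Invariant zero    i = just i
ψ₂^-Invariant (suc n) i = any->>= (ψ₂^-Invariant n i) ψ₂-Invariant

ψ₂-after-ρ₁ : ∀ {l} → Strict l → Any (Is-just ∘ ψ₂) (ρ₁ l)
ψ₂-after-ρ₁ {l} s =
  ρ₁-defined (m≤n⇒m≤n+o 2 (length≤firstRow s))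
             (ψ₂-defined (m≤n⇒m≤n+o 3 (firstRow-ρ₁′≤firstCol l)) tt)

∅-Invariant : Invariant ∅
∅-Invariant = record { strict = [] ; bounded = z≤n }

ρ₁∅-Invariant : Invariant (1 ∷ [])
ρ₁∅-Invariant = record { strict = s≤s z≤n ∷ [] ; bounded = s≤s z≤n }

proposition4p3 : (n : ℕ) →
    Is-just (ψ₂^ n ∅)
    × Is-just (ρ₁ ∅ >>= ψ₂^ n)
    × Is-just (ψ₂^ n ∅ >>= ρ₁)
    × Is-just (ψ₂^ n ∅ >>= ρ₁ >>= ψ₂)
proposition4p3 n =
    Any.map (const tt) (ψ₂^-Invariant n ∅-Invariant)
  , Any.map (const tt) (ψ₂^-Invariant n ρ₁∅-Invariant)
  , Any.map (const tt) ρ₁-then-ψ₂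
  , any->>= ρ₁-then-ψ₂ id
  where
  ρ₁-then-ψ₂ : Any (Is-just ∘ ψ₂) (ψ₂^ n ∅ >>= ρ₁)
  ρ₁-then-ψ₂ = any->>= (ψ₂^-Invariant n ∅-Invariant) (ψ₂-after-ρ₁ ∘ strict)
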